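{- Let $X$ be a finite set and let $\mathcal{D}\subseteq\mathcal{R}(X)$ be a Condorcet domain. Let $R\in\mathcal{R}(X)$ be the majority relation of some odd profile over $\mathcal{D}$. Then $\mathcal{D}\cup\{R\}$ is again a Condorcet domain. In particular, every Condorcet domain is contained in a closed Condorcet domain.
   Context: $\mathcal{R}(X)$ denotes the set of all strict linear orders on the finite set $X$; a domain is any subset of $\mathcal{R}(X)$. A profile over $\mathcal{D}$ is a tuple $(R_1,\dots,R_n)\in\mathcal{D}^n$ for some $n\ge 1$; it is odd if $n$ is odd. Its majority relation $P$ is defined by $xPy$ iff more than half of the $n$ voters rank $x$ above $y$. An asymmetric relation $P$ is acyclic if there are no $x_1,\dots,x_m\in X$ with $x_1Px_2,\dots,x_{m-1}Px_m, x_mPx_1$. A domain $\mathcal{D}$ is a Condorcet domain if the majority relation of every profile over $\mathcal{D}$ is acyclic. A Condorcet domain $\mathcal{D}$ is closed if the majority relation of every odd profile over $\mathcal{D}$ is an element of $\mathcal{D}$. -}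

module Defs where

open import Data.Nat using (ℕ; zero; suc; _+_; _*_; _<_)
open import Data.Fin using (Fin; zero; suc; inject₁; fromℕ)
open import Data.Bool using (Bool; true; false)
open import Data.Product using (Σ; ∃; _×_; _,_; proj₁)
open import Data.Sum using (_⊎_)
open import Relation.Binary.PropositionalEquality using (_≡_; _≢_)
open import Relation.Nullary using (¬_)
open import Function.Bundles using (_⇔_)

-- The finite set X is taken to be Fin m (any finite set is in bijection with some Fin m).

-- A binary relation on Fin m, given by its (decidable) characteristic function:
-- r x y ≡ true  means "x is ranked above y".
BRel : ℕ → Set
BRel m = Fin m → Fin m → Bool

record IsStrictLinearOrder {m : ℕ} (r : BRel m) : Set where
  field
    irrefl : ∀ x → r x x ≡ false
    trans  : ∀ x y z → r x y ≡ true → r y z ≡ true → r x z ≡ true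
    total  : ∀ x y → x ≢ y → (r x y ≡ true) ⊎ (r y x ≡ true)

LinOrd : ℕ → Set
LinOrd m = Σ (BRel m) IsStrictLinearOrder

rel : ∀ {m} → LinOrd m → BRel m
rel = proj₁

Domain : ℕ → Set₁
Domain m = LinOrd m → Set

Profile : ℕ → ℕ → Set
Profile m n = Fin n → LinOrd m

-- profile over 𝓓 (n ≥ 1 is required separately)
OverDomain : ∀ {m n} → Domain m → Profile m n → Set
OverDomain {n = n} D p = (i : Fin n) → D (p i)

countTrue : ∀ {n} → (Fin n → Bool) → ℕ
countTrue {zero} f = 0
countTrue {suc n} f with f zero
... | true  = suc (countTrue (λ i → f (suc i)))
... | false = countTrue (λ i → f (suc i))

Majority : ∀ {m n} → Profile m n → Fin m → Fin m → Set
Majority {n = n} p x y = n < 2 * countTrue (λ i → rel (p i) x y)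

Odd : ℕ → Set
Odd n = ∃ λ k → n ≡ suc (2 * k)

-- a cycle x₀ P x₁ P ... P x_k P x₀ (k+1 ≥ 1 elements)
Cycle : ∀ {m} → (Fin m → Fin m → Set) → Set
Cycle {m} P = ∃ λ k → Σ (Fin (suc k) → Fin m) λ f →
  ((i : Fin k) → P (f (inject₁ i)) (f (suc i))) × P (f (fromℕ k)) (f zero)

Acyclic : ∀ {m} → (Fin m → Fin m → Set) → Set
Acyclic P = ¬ Cycle P

IsCondorcet : ∀ {m} → Domain m → Set
IsCondorcet {m} D = ∀ n (p : Profile m n) → 0 < n → OverDomain D p → Acyclic (Majority p)

MajorityIs : ∀ {m n} → Profile m n → LinOrd m → Set
MajorityIs {m} p R = (x y : Fin m) → Majority p x y ⇔ (rel R x y ≡ true)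

IsOddMajorityOf : ∀ {m} → Domain m → LinOrd m → Set
IsOddMajorityOf {m} D R = ∃ λ n → Σ (Profile m n) λ p → Odd n × OverDomain D p × MajorityIs p R

-- 𝓓 ∪ {R}  (membership of {R} up to equality of the relations)
_∪｛_｝ : ∀ {m} → Domain m → LinOrd m → Domain m
(D ∪｛ R ｝) Q = D Q ⊎ (∀ x y → rel Q x y ≡ rel R x y)

IsClosed : ∀ {m} → Domain m → Set
IsClosed {m} D = IsCondorcet D ×
  (∀ n (p : Profile m n) → Odd n → OverDomain D p → ∃ λ R → D R × MajorityIs p R)

_⊆_ : ∀ {m} → Domain m → Domain m → Set
_⊆_ {m} D E = ∀ (Q : LinOrd m) → D Q → E Q

module Submission where

-- Call E chain-covered by D when every chain x ≻ y ≻ z of an order in E is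
-- also a chain of some order in D.  The heart of the proof is a transfer
-- theorem: if D is Condorcet and E is chain-covered by D, then E is Condorcet.
-- For an odd profile over E the majority relation is a tournament, and a
-- cycle in a tournament contains a triangle a P b P c P a.  Two strict
-- majorities always share a voter, so a ≻ b ≻ c, b ≻ c ≻ a and c ≻ a ≻ b are
-- chains of voters in E, hence of orders Q₁, Q₂, Q₃ in D; the three-voter
-- profile (Q₁, Q₂, Q₃) over D then has the majority cycle a, b, c, which is
-- impossible.  An even profile is reduced to an odd one by counting one voter
-- twice, which preserves every strict majority.
--
-- Both parts of the theorem are instances of the transfer theorem: D ∪ {R} is
-- chain-covered by D because each chain of R is a chain of a voter of the
-- profile realising R, and the inductive closure of D under odd majority
-- relations is chain-covered by D by the same argument, hence Condorcet;
-- its odd majority relations are therefore acyclic tournaments, i.e. linear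
-- orders, which lie in the closure by construction.

open import Defs
open import Data.Nat using (ℕ; zero; suc; _+_; _*_; _≤_; _<_; z≤n; s≤s; _<?_)
open import Data.Nat.Properties
  using (≤-refl; ≤-trans; n≤1+n; m≤n⇒m≤1+n; m+n≤o⇒n≤o; +-suc; +-identityʳ; +-monoʳ-≤; +-mono-≤;
         *-suc; *-monoʳ-≤; *-distribˡ-+; *-cancelˡ-<; 1+n≰n; ≮⇒≥; module ≤-Reasoning)
open import Data.Fin using (Fin; zero; suc; inject₁; fromℕ)
open import Data.Fin.Properties using () renaming (_≟_ to _≟ᶠ_)
open import Data.Bool using (Bool; true; false; _∧_; _∨_)
open import Data.Bool.Properties using (∨-zeroʳ)
open import Data.Product using (∃; _×_; _,_; proj₂)
open import Data.Sum using (_⊎_; inj₁; inj₂) renaming (map to ⊎-map)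
open import Data.Empty using (⊥; ⊥-elim)
open import Function using (_∘_)
open import Relation.Nullary using (¬_; Dec; yes; no; does)
open import Relation.Nullary.Decidable using (dec-true; dec-false)
open import Relation.Binary.Definitions using (DecidableEquality)
open import Relation.Binary.Construct.Closure.ReflexiveTransitive using (Star; ε; _◅_)
open import Relation.Binary.PropositionalEquality using (_≡_; _≢_; refl; sym; trans; cong; subst; subst₂)
open import Function.Bundles using (mk⇔; Equivalence)

countTrue-tail≤ : ∀ {n} (f : Fin (suc n) → Bool) → countTrue (λ i → f (suc i)) ≤ countTrue f
countTrue-tail≤ f with f zero
... | true  = n≤1+n _
... | false = ≤-refl

countTrue-none : ∀ {n} (f : Fin n → Bool) → (∀ i → f i ≡ false) → countTrue f ≡ 0
countTrue-none {zero}  f none = refl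
countTrue-none {suc n} f none rewrite none zero = countTrue-none (λ i → f (suc i)) (none ∘ suc)

countTrue-witness : ∀ {n} (f : Fin n → Bool) → 0 < countTrue f → ∃ λ i → f i ≡ true
countTrue-witness {suc n} f pos with f zero in f₀
... | true  = zero , f₀
... | false with countTrue-witness (λ i → f (suc i)) pos
...   | i , fi = suc i , fi

countTrue-≥1 : ∀ {n} (f : Fin n → Bool) i → f i ≡ true → 1 ≤ countTrue f
countTrue-≥1 f zero    fi rewrite fi = s≤s z≤n
countTrue-≥1 f (suc i) fi = ≤-trans (countTrue-≥1 (λ j → f (suc j)) i fi) (countTrue-tail≤ f)

countTrue-≥2 : ∀ {n} (f : Fin n → Bool) {i j} → i ≢ j → f i ≡ true → f j ≡ true → 2 ≤ countTrue f
countTrue-≥2 f {zero}  {zero}  i≢j _  _  = ⊥-elim (i≢j refl)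
countTrue-≥2 f {zero}  {suc j} _   fi fj rewrite fi = s≤s (countTrue-≥1 (λ k → f (suc k)) j fj)
countTrue-≥2 f {suc i} {zero}  _   fi fj rewrite fj = s≤s (countTrue-≥1 (λ k → f (suc k)) i fi)
countTrue-≥2 f {suc i} {suc j} i≢j fi fj =
  ≤-trans (countTrue-≥2 (λ k → f (suc k)) (i≢j ∘ cong suc) fi fj) (countTrue-tail≤ f)

countTrue-∧ : ∀ {n} (f g : Fin n → Bool) →
  countTrue f + countTrue g ≤ n + countTrue (λ i → f i ∧ g i)
countTrue-∧ {zero}  f g = z≤n
countTrue-∧ {suc n} f g with f zero | g zero | countTrue-∧ (f ∘ suc) (g ∘ suc)
... | true  | true  | ih = s≤s (subst₂ _≤_ (sym (+-suc a b)) (sym (+-suc n c)) (s≤s ih))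
  where a = countTrue (f ∘ suc); b = countTrue (g ∘ suc); c = countTrue (λ i → f (suc i) ∧ g (suc i))
... | true  | false | ih = s≤s ih
... | false | true  | ih = subst (_≤ suc n + c) (sym (+-suc a b)) (s≤s ih)
  where a = countTrue (f ∘ suc); b = countTrue (g ∘ suc); c = countTrue (λ i → f (suc i) ∧ g (suc i))
... | false | false | ih = m≤n⇒m≤1+n ih

countTrue-∨ : ∀ {n} (f g : Fin n → Bool) → (∀ i → (f i ∨ g i) ≡ true) →
  n ≤ countTrue f + countTrue g
countTrue-∨ {zero}  f g cover = z≤n
countTrue-∨ {suc n} f g cover
  with f zero | g zero | cover zero | countTrue-∨ (f ∘ suc) (g ∘ suc) (cover ∘ suc)
... | true  | true  | _  | ih = s≤s (≤-trans ih (+-monoʳ-≤ (countTrue (f ∘ suc)) (n≤1+n _)))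
... | true  | false | _  | ih = s≤s ih
... | false | true  | _  | ih = subst (suc n ≤_) (sym (+-suc (countTrue (f ∘ suc)) (countTrue (g ∘ suc)))) (s≤s ih)
... | false | false | () | _

majorities-overlap : ∀ n a b c → n < 2 * a → n < 2 * b → a + b ≤ n + c → 0 < c
majorities-overlap n a b (suc c) _    _    _     = s≤s z≤n
majorities-overlap n a b zero    n<2a n<2b a+b≤n = ⊥-elim (1+n≰n (m+n≤o⇒n≤o 1 too-many))
  where
  open ≤-Reasoning
  too-many : 2 + (n + n) ≤ n + n
  too-many = begin
    2 + (n + n)   ≡⟨ cong suc (sym (+-suc n n)) ⟩
    suc n + suc n ≤⟨ +-mono-≤ n<2a n<2b ⟩
    2 * a + 2 * b ≡⟨ sym (*-distribˡ-+ 2 a b) ⟩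
    2 * (a + b)   ≤⟨ *-monoʳ-≤ 2 (subst (a + b ≤_) (+-identityʳ n) a+b≤n) ⟩
    n + (n + 0)   ≡⟨ cong (n +_) (+-identityʳ n) ⟩
    n + n         ∎

odd-majority : ∀ {k c} → k < c → suc (2 * k) < 2 * c
odd-majority {k} {c} k<c = subst (_≤ 2 * c) (*-suc 2 k) (*-monoʳ-≤ 2 k<c)

odd-split : ∀ k a b → suc (2 * k) ≤ a + b → k < a ⊎ k < b
odd-split k a b a+b≥n with k <? a | k <? b
... | yes k<a | _       = inj₁ k<a
... | no _    | yes k<b = inj₂ k<b
... | no k≮a  | no k≮b  = ⊥-elim (1+n≰n too-few)
  where
  open ≤-Reasoning
  too-few : suc (k + k) ≤ k + k
  too-few = begin
    suc (k + k)       ≡⟨ cong (λ x → suc (k + x)) (sym (+-identityʳ k)) ⟩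
    suc (2 * k)       ≤⟨ a+b≥n ⟩
    a + b             ≤⟨ +-mono-≤ (≮⇒≥ k≮a) (≮⇒≥ k≮b) ⟩
    k + k             ∎

Even : ℕ → Set
Even n = ∃ λ k → n ≡ 2 * k

parity : ∀ n → Odd n ⊎ Even n
parity zero = inj₂ (0 , refl)
parity (suc n) with parity n
... | inj₁ (k , n≡1+2k) = inj₂ (suc k , cong suc (trans n≡1+2k (sym (+-suc k (k + 0)))))
... | inj₂ (k , n≡2k)   = inj₁ (k , cong suc n≡2k)

Chain : ∀ {m} → LinOrd m → Fin m → Fin m → Fin m → Set
Chain Q x y z = (rel Q x y ≡ true) × (rel Q y z ≡ true)

not-both : ∀ {m} (Q : LinOrd m) x y → rel Q x y ≡ true → rel Q y x ≡ true → ⊥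
not-both (r , lin) x y xy yx
  with trans (sym (IsStrictLinearOrder.trans lin x y x xy yx)) (IsStrictLinearOrder.irrefl lin x)
... | ()

one-of : ∀ {m} (Q : LinOrd m) x y → x ≢ y → (rel Q x y ∨ rel Q y x) ≡ true
one-of (r , lin) x y x≢y with IsStrictLinearOrder.total lin x y x≢y
... | inj₁ xy = cong (_∨ r y x) xy
... | inj₂ yx = trans (cong (r x y ∨_) yx) (∨-zeroʳ (r x y))

∧-true : ∀ {a b} → (a ∧ b) ≡ true → (a ≡ true) × (b ≡ true)
∧-true {true} {true} _ = refl , refl

module _ {m n : ℕ} (q : Profile m n) where

  majority-irreflexive : ∀ x → ¬ Majority q x x
  majority-irreflexive x x≻x
    with subst (λ c → n < 2 * c) (countTrue-none _ (λ i → IsStrictLinearOrder.irrefl (proj₂ (q i)) x)) x≻x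
  ... | ()

  -- Two strict majorities overlap: x P y and y P z give a voter ranking x ≻ y ≻ z.
  majority-chain : ∀ x y z → Majority q x y → Majority q y z → ∃ λ i → Chain (q i) x y z
  majority-chain x y z xy yz
    with countTrue-witness (λ i → f i ∧ g i)
           (majorities-overlap n (countTrue f) (countTrue g) _ xy yz (countTrue-∧ f g))
    where
    f g : Fin n → Bool
    f i = rel (q i) x y
    g i = rel (q i) y z
  ... | i , fg = i , ∧-true fg

  majority-asymmetric : ∀ x y → Majority q x y → ¬ Majority q y x
  majority-asymmetric x y xy yx with majority-chain x y x xy yx
  ... | i , x≻y , y≻x = not-both (q i) x y x≻y y≻x

  majority-relation-chain : ∀ {R} → MajorityIs q R → ∀ {x y z} → Chain R x y z →
    ∃ λ i → Chain (q i) x y z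
  majority-relation-chain is (xy , yz) =
    majority-chain _ _ _ (Equivalence.from (is _ _) xy) (Equivalence.from (is _ _) yz)

majority-total : ∀ {m n} (q : Profile m n) → Odd n → ∀ x y → x ≢ y →
  Majority q x y ⊎ Majority q y x
majority-total q (k , refl) x y x≢y
  with odd-split k (countTrue xy) (countTrue yx) (countTrue-∨ xy yx (λ i → one-of (q i) x y x≢y))
  where
  xy yx : Fin _ → Bool
  xy i = rel (q i) x y
  yx i = rel (q i) y x
... | inj₁ k<xy = inj₁ (odd-majority k<xy)
... | inj₂ k<yx = inj₂ (odd-majority k<yx)

countFirstTwice : ∀ {n} → Fin (suc (suc n)) → Fin (suc n)
countFirstTwice zero    = zero
countFirstTwice (suc i) = i

majority-countFirstTwice : ∀ {m n} (q : Profile m (suc n)) → Even (suc n) →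
  ∀ x y → Majority q x y → Majority (q ∘ countFirstTwice) x y
majority-countFirstTwice q (k , n≡2k) x y n<2c =
  ≤-trans (subst (λ N → suc N < 2 * c) (sym n≡2k) (odd-majority k<c))
          (*-monoʳ-≤ 2 (countTrue-tail≤ (λ i → rel (q (countFirstTwice i)) x y)))
  where
  c : ℕ
  c = countTrue (λ i → rel (q i) x y)
  -- 2k < 2c, so more than k of the 2k + 1 voters agree.
  k<c : k < c
  k<c = *-cancelˡ-< 2 k c (subst (_< 2 * c) n≡2k n<2c)

two-of-three : ∀ {m} (r : Profile m 3) {i j} → i ≢ j → ∀ {x y} →
  rel (r i) x y ≡ true → rel (r j) x y ≡ true → Majority r x y
two-of-three r i≢j ri rj = odd-majority {1} (countTrue-≥2 _ i≢j ri rj)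

Triangle : ∀ {A : Set} → (A → A → Set) → Set
Triangle P = ∃ λ a → ∃ λ b → ∃ λ c → P a b × P b c × P c a

-- In a tournament (irreflexive, asymmetric, complete) a walk a ⇝ b closed by
-- b P a contains a triangle: shortcut the walk using completeness.
closed-walk-triangle : ∀ {A : Set} (_≟_ : DecidableEquality A) (P : A → A → Set) →
  (∀ a → ¬ P a a) → (∀ a b → P a b → ¬ P b a) → (∀ a b → a ≢ b → P a b ⊎ P b a) →
  ∀ {a b} → Star P a b → P b a → Triangle P
closed-walk-triangle _≟_ P irrefl asym total ε ba = ⊥-elim (irrefl _ ba)
closed-walk-triangle _≟_ P irrefl asym total {a} {b} (_◅_ {j = c} ac cb) ba with b ≟ c
... | yes refl = ⊥-elim (asym _ _ ac ba)
... | no b≢c with total b c b≢c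
...   | inj₁ bc = closed-walk-triangle _≟_ P irrefl asym total cb bc
...   | inj₂ cb = a , c , b , ac , cb , ba

cycle-walk : ∀ {m} {P : Fin m → Fin m → Set} k (f : Fin (suc k) → Fin m) →
  ((i : Fin k) → P (f (inject₁ i)) (f (suc i))) → Star P (f zero) (f (fromℕ k))
cycle-walk zero    f edges = ε
cycle-walk (suc k) f edges = edges zero ◅ cycle-walk k (f ∘ suc) (edges ∘ suc)

cycle-triangle : ∀ {m} {P : Fin m → Fin m → Set} →
  (∀ a → ¬ P a a) → (∀ a b → P a b → ¬ P b a) → (∀ a b → a ≢ b → P a b ⊎ P b a) →
  Cycle P → Triangle P
cycle-triangle irrefl asym total (k , f , edges , back) =
  closed-walk-triangle _≟ᶠ_ _ irrefl asym total (cycle-walk k f edges) back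

triangle-cycle : ∀ {m} {P : Fin m → Fin m → Set} → Triangle P → Cycle P
triangle-cycle {P = P} (a , b , c , ab , bc , ca) = 2 , vertex , edges , ca
  where
  vertex : Fin 3 → _
  vertex zero             = a
  vertex (suc zero)       = b
  vertex (suc (suc zero)) = c
  edges : (i : Fin 2) → P (vertex (inject₁ i)) (vertex (suc i))
  edges zero       = ab
  edges (suc zero) = bc

mapCycle : ∀ {m} {P P′ : Fin m → Fin m → Set} → (∀ a b → P a b → P′ a b) → Cycle P → Cycle P′
mapCycle P⊆P′ (k , f , edges , back) = k , f , (λ i → P⊆P′ _ _ (edges i)) , P⊆P′ _ _ back

ChainCovered : ∀ {m} → Domain m → Domain m → Set
ChainCovered {m} E D = ∀ Q → E Q → ∀ {x y z} → Chain Q x y z → ∃ λ Q′ → D Q′ × Chain Q′ x y z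

odd-majority-acyclic : ∀ {m} {D E : Domain m} → IsCondorcet D → ChainCovered E D →
  ∀ {n} (q : Profile m n) → Odd n → OverDomain E q → Acyclic (Majority q)
odd-majority-acyclic {D = D} cD covered q odd over cycle
  with cycle-triangle (majority-irreflexive q) (majority-asymmetric q) (majority-total q odd) cycle
... | a , b , c , ab , bc , ca
  with lift ab bc | lift bc ca | lift ca ab
  where
  lift : ∀ {x y z} → Majority q x y → Majority q y z → ∃ λ Q → D Q × Chain Q x y z
  lift xy yz with majority-chain q _ _ _ xy yz
  ... | i , chain = covered (q i) (over i) chain
... | Q₁ , D₁ , a≻b₁ , b≻c₁ | Q₂ , D₂ , b≻c₂ , c≻a₂ | Q₃ , D₃ , c≻a₃ , a≻b₃ =
  cD 3 r (s≤s z≤n) r-over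
     (triangle-cycle {P = Majority r}
       (a , b , c , two-of-three r {zero}     {suc (suc zero)} (λ ()) a≻b₁ a≻b₃
                  , two-of-three r {zero}     {suc zero}       (λ ()) b≻c₁ b≻c₂
                  , two-of-three r {suc zero} {suc (suc zero)} (λ ()) c≻a₂ c≻a₃))
  where
  r : Profile _ 3
  r zero             = Q₁
  r (suc zero)       = Q₂
  r (suc (suc zero)) = Q₃
  r-over : OverDomain D r
  r-over zero             = D₁
  r-over (suc zero)       = D₂
  r-over (suc (suc zero)) = D₃

chain-covered-Condorcet : ∀ {m} {D E : Domain m} → IsCondorcet D → ChainCovered E D → IsCondorcet E
chain-covered-Condorcet cD covered (suc n) q _ over cycle with parity (suc n)
... | inj₁ odd = odd-majority-acyclic cD covered q odd over cycle
... | inj₂ even@(k , n≡2k) =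
  odd-majority-acyclic cD covered (q ∘ countFirstTwice) (k , cong suc n≡2k) (over ∘ countFirstTwice)
    (mapCycle (majority-countFirstTwice q even) cycle)

union-covered : ∀ {m n} {D : Domain m} {R : LinOrd m} (p : Profile m n) →
  OverDomain D p → MajorityIs p R → ChainCovered (D ∪｛ R ｝) D
union-covered p over is Q (inj₁ DQ) chain = Q , DQ , chain
union-covered {R = R} p over is Q (inj₂ Q≡R) {x} {y} {z} (xy , yz)
  with majority-relation-chain p {R} is (trans (sym (Q≡R x y)) xy , trans (sym (Q≡R y z)) yz)
... | i , chain = p i , over i , chain

data Closure {m : ℕ} (D : Domain m) : Domain m where
  base     : ∀ {Q} → D Q → Closure D Q
  majority : ∀ {Q} n (p : Profile m n) → Odd n → (∀ i → Closure D (p i)) → MajorityIs p Q → Closure D Q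

closure-covered : ∀ {m} {D : Domain m} → ChainCovered (Closure D) D
closure-covered Q (base DQ) chain = Q , DQ , chain
closure-covered Q (majority n p _ over is) chain with majority-relation-chain p {Q} is chain
... | i , chainᵢ = closure-covered (p i) (over i) chainᵢ

majorityRel : ∀ {m n} → Profile m n → BRel m
majorityRel {n = n} p x y = does (n <? 2 * countTrue (λ i → rel (p i) x y))

does⇒ : ∀ {A : Set} (a? : Dec A) → does a? ≡ true → A
does⇒ (yes a) _ = a

majorityRel-sound : ∀ {m n} (p : Profile m n) {x y} → majorityRel p x y ≡ true → Majority p x y
majorityRel-sound p = does⇒ (_ <? _)

majority-linear : ∀ {m n} (p : Profile m n) → Odd n → Acyclic (Majority p) →
  IsStrictLinearOrder (majorityRel p)
majority-linear p odd acyclic = record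
  { irrefl = λ x → dec-false (_ <? _) (majority-irreflexive p x)
  ; trans  = transitive
  ; total  = λ x y x≢y → ⊎-map (dec-true (_ <? _)) (dec-true (_ <? _)) (majority-total p odd x y x≢y)
  }
  where
  transitive : ∀ x y z → majorityRel p x y ≡ true → majorityRel p y z ≡ true → majorityRel p x z ≡ true
  transitive x y z xy yz with x ≟ᶠ z
  ... | yes refl = ⊥-elim (majority-asymmetric p x y (majorityRel-sound p xy) (majorityRel-sound p yz))
  ... | no x≢z with majority-total p odd x z x≢z
  ...   | inj₁ xz = dec-true (_ <? _) xz
  ...   | inj₂ zx = ⊥-elim (acyclic (triangle-cycle {P = Majority p}
                      (x , y , z , majorityRel-sound p xy , majorityRel-sound p yz , zx)))

lemma2p1 : (m : ℕ) →
    ((D : Domain m) (R : LinOrd m) → IsCondorcet D → IsOddMajorityOf D R →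
      IsCondorcet (D ∪｛ R ｝))
    × ((D : Domain m) → IsCondorcet D → ∃ λ (E : Domain m) → (D ⊆ E) × IsClosed E)
lemma2p1 m = union-Condorcet , closure-closed
  where
  union-Condorcet : (D : Domain m) (R : LinOrd m) → IsCondorcet D → IsOddMajorityOf D R →
    IsCondorcet (D ∪｛ R ｝)
  union-Condorcet D R cD (n , p , _ , over , is) =
    chain-covered-Condorcet cD (union-covered {D = D} {R = R} p over is)

  closure-closed : (D : Domain m) → IsCondorcet D → ∃ λ (E : Domain m) → (D ⊆ E) × IsClosed E
  closure-closed D cD = Closure D , (λ _ → base) , cClosure , closed
    where
    cClosure : IsCondorcet (Closure D)
    cClosure = chain-covered-Condorcet cD (closure-covered {D = D})
    closed : ∀ n (p : Profile m n) → Odd n → OverDomain (Closure D) p →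
      ∃ λ R → Closure D R × MajorityIs p R
    closed n p odd@(k , refl) over = R , majority n p odd over is , is
      where
      R : LinOrd m
      R = majorityRel p , majority-linear p odd (cClosure n p (s≤s z≤n) over)
      is : MajorityIs p R
      is x y = mk⇔ (dec-true (_ <? _)) (majorityRel-sound p)
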